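{- Let $n\ge0$. Up to isomorphism: (1) there are $2^n$ gluing-parallel starters and $2^n$ gluing-parallel terminators on $n$ points; (2) there are $\sum_{k=0}^n \frac{n!}{k!}$ starters and $\sum_{k=0}^n\frac{n!}{k!}$ terminators on $n$ points; (3) there are $\sum_{s,t=0}^n\sum_{u=\max(0,s+t-n)}^{\min(s,t)}\binom{s}{u}\binom{t}{u}$ discrete gluing-parallel iposets on $n$ points; (4) there are $\sum_{s,t=0}^n\sum_{u=\max(0,s+t-n)}^{\min(s,t)}\binom{s}{u}\binom{t}{u}\,u!$ discrete iposets on $n$ points.
   Context: A poset is a finite set with an irreflexive transitive relation $<$; $P^{\min}$, $P^{\max}$ are its minimal and maximal elements. $[n]=\{1,\dots,n\}$, $[0]=\emptyset$. An iposet $(s,P,t):n\to m$ is a poset $P$ with injective maps $s:[n]\to P$, $t:[m]\to P$, $s([n])\subseteq P^{\min}$, $t([m])\subseteq P^{\max}$; it has $|P|$ points. Iposets $(s_1,P_1,t_1)$, $(s_2,P_2,t_2)$ are isomorphic if there is a poset isomorphism $f:P_1\to P_2$ with $f\circ s_1=s_2$, $f\circ t_1=t_2$. Parallel composition $P_1\otimes P_2:n_1+n_2\to m_1+m_2$ of $(s_1,P_1,t_1):n_1\to m_1$ and $(s_2,P_2,t_2):n_2\to m_2$: carrier $P_1\sqcup P_2$, order $(p,i)<(q,j)$ iff $i=j$ and $p<_iq$, source map $i\mapsto(s_1(i),1)$ for $i\le n_1$ and $i\mapsto(s_2(i-n_1),2)$ for $i>n_1$, target map analogous. Gluing $P_1\ast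 P_2:n_1\to m_2$ (defined when $m_1=n_2$): carrier the quotient of $P_1\sqcup P_2$ identifying $(t_1(k),1)$ with $(s_2(k),2)$ for $k\in[m_1]$, order $(p,i)<(q,j)$ iff ($i=j$ and $p<_iq$) or ($i<j$, $p\notin t_1([m_1])$, $q\notin s_2([n_2])$), source induced by $s_1$, target induced by $t_2$. An iposet is gluing-parallel if it is empty or obtained from the four iposets on a one-point poset (with $0$ or $1$ source and $0$ or $1$ target points) by finitely many applications of $\ast$ and $\otimes$. An iposet $(s,P,t)$ is discrete if the order of $P$ is empty, a starter if it is discrete and $t$ is bijective, and a terminator if it is discrete and $s$ is bijective. -}

module Defs where

open import Level using (Level) renaming (suc to lsuc)
open import Data.Nat using (ℕ; zero; suc; _+_; _*_; _∸_; _⊓_; _/_; _!; _≤_)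
open import Data.Nat.Properties using (_!≢0)
open import Data.Nat.Combinatorics using (_C_)
open import Data.Fin using (Fin; splitAt)
open import Data.List using (List; map; upTo)
open import Data.Nat.ListAction using (sum)
open import Data.Sum using (_⊎_; inj₁; inj₂; [_,_]′)
open import Data.Product using (Σ; ∃; _×_; _,_)
open import Data.Empty using (⊥)
open import Relation.Nullary using (¬_)
open import Relation.Binary.PropositionalEquality using (_≡_)
open import Function using (_∘_)
open import Function.Bundles using (_↔_; _⇔_; Inverse)
open import Function.Definitions using (Injective; Bijective)

-- Iposets  (s , P , t) : n → m
-- P is a finite poset (strict order: irreflexive, transitive), given on an
-- arbitrary carrier type together with a bijection to Fin points
-- (so  points  is |P|).

record Iposet (n m : ℕ) : Set₁ where
  field
    Carrier : Set
    _≺_     : Carrier → Carrier → Set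
    irrefl  : ∀ x → ¬ (x ≺ x)
    trans   : ∀ {x y z} → x ≺ y → y ≺ z → x ≺ z
    points  : ℕ
    enum    : Carrier ↔ Fin points
    src     : Fin n → Carrier
    tgt     : Fin m → Carrier
    src-inj : Injective _≡_ _≡_ src
    tgt-inj : Injective _≡_ _≡_ tgt
    src-min : ∀ i x → ¬ (x ≺ src i)
    tgt-max : ∀ i x → ¬ (tgt i ≺ x)

open Iposet

_≅_ : ∀ {n m} → Iposet n m → Iposet n m → Set
P ≅ Q = Σ (Carrier P ↔ Carrier Q) λ f →
          (∀ x y → (_≺_ P x y) ⇔ (_≺_ Q (Inverse.to f x) (Inverse.to f y)))
        × (∀ i → Inverse.to f (src P i) ≡ src Q i)
        × (∀ j → Inverse.to f (tgt P j) ≡ tgt Q j)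

-- Parallel composition, up to isomorphism: P is (isomorphic to) P₁ ⊗ P₂,
-- where P₁ ⊗ P₂ has carrier P₁ ⊔ P₂ (here Carrier P₁ ⊎ Carrier P₂).

module _ {n₁ m₁ n₂ m₂ : ℕ} (P₁ : Iposet n₁ m₁) (P₂ : Iposet n₂ m₂) where

  ParOrd : Carrier P₁ ⊎ Carrier P₂ → Carrier P₁ ⊎ Carrier P₂ → Set
  ParOrd (inj₁ p) (inj₁ q) = _≺_ P₁ p q
  ParOrd (inj₂ p) (inj₂ q) = _≺_ P₂ p q
  ParOrd _        _        = ⊥

  parSrc : Fin (n₁ + n₂) → Carrier P₁ ⊎ Carrier P₂
  parSrc i = [ inj₁ ∘ src P₁ , inj₂ ∘ src P₂ ]′ (splitAt n₁ i)

  parTgt : Fin (m₁ + m₂) → Carrier P₁ ⊎ Carrier P₂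
  parTgt j = [ inj₁ ∘ tgt P₁ , inj₂ ∘ tgt P₂ ]′ (splitAt m₁ j)

  IsParallel : Iposet (n₁ + n₂) (m₁ + m₂) → Set
  IsParallel P = Σ ((Carrier P₁ ⊎ Carrier P₂) ↔ Carrier P) λ f →
      (∀ a b → ParOrd a b ⇔ _≺_ P (Inverse.to f a) (Inverse.to f b))
    × (∀ i → Inverse.to f (parSrc i) ≡ src P i)
    × (∀ j → Inverse.to f (parTgt j) ≡ tgt P j)

-- Gluing P₁ ∗ P₂, up to isomorphism: the carrier of P is the quotient of
-- P₁ ⊔ P₂ identifying (t₁ k , 1) with (s₂ k , 2), presented by a surjection
-- q : P₁ ⊔ P₂ → P whose kernel is exactly that identification; the order on
-- the quotient is: [a] < [b] iff some representatives satisfy the relation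
-- given in the definition of ∗.

module _ {n k m : ℕ} (P₁ : Iposet n k) (P₂ : Iposet k m) where

  GlueOrd : Carrier P₁ ⊎ Carrier P₂ → Carrier P₁ ⊎ Carrier P₂ → Set
  GlueOrd (inj₁ p) (inj₁ q) = _≺_ P₁ p q
  GlueOrd (inj₂ p) (inj₂ q) = _≺_ P₂ p q
  GlueOrd (inj₁ p) (inj₂ q) = (¬ ∃ λ l → tgt P₁ l ≡ p) × (¬ ∃ λ l → src P₂ l ≡ q)
  GlueOrd (inj₂ p) (inj₁ q) = ⊥

  -- the equivalence relation generated by (t₁ l , 1) ~ (s₂ l , 2)
  -- (already an equivalence since t₁ and s₂ are injective)
  Identified : Carrier P₁ ⊎ Carrier P₂ → Carrier P₁ ⊎ Carrier P₂ → Set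
  Identified a b = a ≡ b
    ⊎ (∃ λ l → a ≡ inj₁ (tgt P₁ l) × b ≡ inj₂ (src P₂ l))
    ⊎ (∃ λ l → a ≡ inj₂ (src P₂ l) × b ≡ inj₁ (tgt P₁ l))

  IsGluing : Iposet n m → Set
  IsGluing P = Σ (Carrier P₁ ⊎ Carrier P₂ → Carrier P) λ q →
      (∀ x → ∃ λ a → q a ≡ x)
    × (∀ a b → (q a ≡ q b) ⇔ Identified a b)
    × (∀ x y → _≺_ P x y ⇔ (∃ λ a → ∃ λ b → q a ≡ x × q b ≡ y × GlueOrd a b))
    × (∀ i → q (inj₁ (src P₁ i)) ≡ src P i)
    × (∀ j → q (inj₂ (tgt P₂ j)) ≡ tgt P j)

data GP : ∀ {n m} → Iposet n m → Set₁ where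
  gp-empty : ∀ {n m} (P : Iposet n m) → points P ≡ 0 → GP P
  gp-one   : ∀ {n m} (P : Iposet n m) → n ≤ 1 → m ≤ 1 → points P ≡ 1 → GP P
  gp-par   : ∀ {n₁ m₁ n₂ m₂} {P₁ : Iposet n₁ m₁} {P₂ : Iposet n₂ m₂}
             (P : Iposet (n₁ + n₂) (m₁ + m₂)) →
             GP P₁ → GP P₂ → IsParallel P₁ P₂ P → GP P
  gp-glue  : ∀ {n k m} {P₁ : Iposet n k} {P₂ : Iposet k m}
             (P : Iposet n m) →
             GP P₁ → GP P₂ → IsGluing P₁ P₂ P → GP P

Discrete : ∀ {n m} → Iposet n m → Set
Discrete P = ∀ x y → ¬ (_≺_ P x y)

Starter : ∀ {n m} → Iposet n m → Set
Starter P = Discrete P × Bijective _≡_ _≡_ (tgt P)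

Terminator : ∀ {n m} → Iposet n m → Set
Terminator P = Discrete P × Bijective _≡_ _≡_ (src P)

record AnyIposet : Set₁ where
  constructor ⟨_,_,_⟩
  field
    nsrc : ℕ
    ntgt : ℕ
    ipo  : Iposet nsrc ntgt

-- isomorphism between iposets with possibly different interfaces
-- (isomorphic iposets necessarily have the same interface)
_≅ₐ_ : AnyIposet → AnyIposet → Set
⟨ n , m , P ⟩ ≅ₐ ⟨ n' , m' , Q ⟩ =
  Σ (n ≡ n') λ { _≡_.refl → Σ (m ≡ m') λ { _≡_.refl → P ≅ Q } }

NumIsoClasses : (AnyIposet → Set₁) → ℕ → Set₁
NumIsoClasses Φ N = Σ (Fin N → AnyIposet) λ rep →
    (∀ i → Φ (rep i))
  × (∀ i j → rep i ≅ₐ rep j → i ≡ j)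
  × (∀ P → Φ P → ∃ λ i → P ≅ₐ rep i)

OnPoints : ℕ → AnyIposet → Set
OnPoints k ⟨ _ , _ , P ⟩ = points P ≡ k

IsGP : AnyIposet → Set₁
IsGP ⟨ _ , _ , P ⟩ = GP P

IsStarter IsTerminator IsDiscrete : AnyIposet → Set
IsStarter    ⟨ _ , _ , P ⟩ = Starter P
IsTerminator ⟨ _ , _ , P ⟩ = Terminator P
IsDiscrete   ⟨ _ , _ , P ⟩ = Discrete P

-- Σ_{j=a}^{b} f j  (empty if b < a)
sumFromTo : ℕ → ℕ → (ℕ → ℕ) → ℕ
sumFromTo a b f = sum (map (λ j → f (a + j)) (upTo (suc b ∸ a)))

starterCount : ℕ → ℕ
starterCount n = sumFromTo 0 n (λ k → _/_ (n !) (k !) {{k !≢0}})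

discreteGPCount : ℕ → ℕ
discreteGPCount n =
  sumFromTo 0 n λ s → sumFromTo 0 n λ t →
    sumFromTo (s + t ∸ n) (s ⊓ t) λ u → (s C u) * (t C u)

discreteCount : ℕ → ℕ
discreteCount n =
  sumFromTo 0 n λ s → sumFromTo 0 n λ t →
    sumFromTo (s + t ∸ n) (s ⊓ t) λ u → (s C u) * (t C u) * (u !)

module Submission where

-- A discrete iposet n → m on N points is, up to isomorphism, determined by which sources coincide
-- with which targets: a partial injection from [n] to [m] matching u of them, subject to
-- n + m − u ≤ N. We make this precise with normal forms ("layouts") on Fin N: every discrete
-- iposet can be relabelled into the layout of its matching, and isomorphic layouts have the
-- same matching. A discrete iposet is gluing-parallel iff its matching is monotone: ordered
-- layouts are parallel compositions of one-point iposets, and gluing and parallel composition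
-- preserve monotonicity of the matching. Counting partial injections (binom(s,u) binom(t,u) u!)
-- and monotone ones (binom(s,u) binom(t,u)), and specialising to starters (all targets, every
-- source matched) and terminators, gives the four formulas.

open import Defs
open import Data.Nat as ℕ using (ℕ; zero; suc; _+_; _*_; _∸_; _^_; _!; _≤_; z≤n; s≤s; s≤s⁻¹; _≤?_; _⊓_)
open import Data.Nat.Properties
  using ( ≤-refl; ≤-reflexive; ≤-trans; ≤-antisym; ≤⇒≯; ≰⇒>; n≮0; 1+n≰n; m≤n⇒m≤1+n; m≤m+n; m≤n+m∸n
        ; <-asym; <-≤-trans; +-suc; +-comm; +-identityʳ; *-assoc; *-zeroʳ; +-monoʳ-≤; +-monoʳ-<
        ; +-cancelˡ-≤; +-cancelʳ-≤; +-cancelˡ-<; m+n≤o⇒m≤o; m∸n≤m; 0∸n≡0; ∸-monoˡ-<; m≤n+o⇒m∸n≤o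
        ; m+n∸m≡n; m+[n∸m]≡n; m∸[m∸n]≡n; ⊓-glb; _!≢0 )
open import Data.Nat.Combinatorics using (_C_; nCk+nC[k+1]≡[n+1]C[k+1])
open import Data.Nat.ListAction using (sum)
open import Data.List using (map; applyUpTo)
open import Data.Fin using (Fin; zero; suc; punchIn; punchOut; _<_; join; toℕ; splitAt; _↑ˡ_; _↑ʳ_)
open import Data.Fin.Properties
  using ( 0↔⊥; 1↔⊤; +↔⊎; *↔×; ¬Fin0; _≟_; any?; suc-injective; injective⇒≤; <⇒≢; toℕ<n
        ; punchInᵢ≢i; punchIn-injective; punchOut-cong; punchOut-punchIn; punchIn-punchOut; punchOut-injective
        ; splitAt-↑ˡ; splitAt-↑ʳ; splitAt⁻¹-↑ˡ; splitAt⁻¹-↑ʳ; toℕ-↑ˡ; toℕ-↑ʳ )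
open import Data.Fin.Permutation
  using (Permutation; Permutation′; insert; insert-punchIn; _⟨$⟩ʳ_; ↔⇒≡) renaming (id to idₚ)
open import Data.Sum using (_⊎_; inj₁; inj₂; [_,_]′)
open import Data.Sum.Properties using (inj₁-injective; inj₂-injective)
open import Data.Sum.Function.Propositional using (_⊎-↔_)
open import Data.Product using (Σ; Σ-syntax; ∃; _×_; _,_; proj₁; proj₂)
open import Data.Product.Function.Dependent.Propositional using (Σ-↔)
open import Data.Product.Function.NonDependent.Propositional using (_×-↔_)
open import Data.Refinement using (Refinement-syntax; _,_; value)
open import Data.Refinement.Properties using (value-injective)
open import Data.Irrelevant using ([_])
open import Data.Unit using (⊤; tt)
open import Data.Empty using (⊥; ⊥-elim; ⊥-elim-irr)
open import Level using (Lift; lift; 0ℓ) renaming (suc to lsuc)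
open import Relation.Nullary using (¬_; yes; no; contradiction)
open import Relation.Nullary.Decidable using (recompute)
open import Relation.Binary.PropositionalEquality
  using (_≡_; _≢_; refl; sym; trans; cong; subst; subst₂; module ≡-Reasoning)
open import Function using (_∘_; id)
open import Function.Bundles using (_↔_; _⇔_; mk⇔; mk⤖; mk↔ₛ′; Inverse; Equivalence; Injection)
open import Function.Definitions using (Injective; Surjective; Bijective)
open import Function.Properties.Inverse using (↔-refl; ↔-sym; ↔-trans; ↔⇒↣)
open import Function.Properties.Bijection using (⤖⇒↔)
open import Function.Related.Propositional using (K-reflexive; module EquationalReasoning)

open Iposet using (Carrier; src; tgt; points; enum; src-inj; tgt-inj)

private
  variable
    a b m n n′ s t u : ℕ

-- Combinations and arrangements

data Combination : ℕ → ℕ → Set where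
  []   : Combination 0 0
  skip : Combination s u → Combination (suc s) u
  take : Combination s u → Combination (suc s) (suc u)

-- u distinct elements of Fin t, each given by its position among the elements not chosen before
data Arrangement : ℕ → ℕ → Set where
  []  : Arrangement t 0
  _∷_ : Fin (suc t) → Arrangement t u → Arrangement (suc t) (suc u)

combination-≤ : Combination s u → u ≤ s
combination-≤ []       = z≤n
combination-≤ (skip c) = m≤n⇒m≤1+n (combination-≤ c)
combination-≤ (take c) = s≤s (combination-≤ c)

arrangement-≤ : Arrangement t u → u ≤ t
arrangement-≤ []      = z≤n
arrangement-≤ (_ ∷ a) = s≤s (arrangement-≤ a)

none : ∀ s → Combination s 0
none zero    = []
none (suc s) = skip (none s)

none-unique : (c : Combination s 0) → c ≡ none s
none-unique []       = refl
none-unique (skip c) = cong skip (none-unique c)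

all : ∀ s → Combination s s
all zero    = []
all (suc s) = take (all s)

all-unique : (c : Combination s s) → c ≡ all s
all-unique []       = refl
all-unique (take c) = cong take (all-unique c)
all-unique (skip c) = contradiction (combination-≤ c) 1+n≰n

⊤↔singleton : ∀ {A : Set} (x : A) → (∀ y → y ≡ x) → ⊤ ↔ A
⊤↔singleton x unique = mk↔ₛ′ (λ _ → x) (λ _ → tt) (λ y → sym (unique y)) (λ _ → refl)

Fin[C]↔Combination : ∀ s u → Fin (s C u) ↔ Combination s u
Fin[C]↔Combination zero    zero    = ↔-trans 1↔⊤ (⊤↔singleton [] λ { [] → refl })
Fin[C]↔Combination zero    (suc u) = ↔-trans 0↔⊥ (mk↔ₛ′ (λ ()) (λ ()) (λ ()) (λ ()))
Fin[C]↔Combination (suc s) zero    = ↔-trans 1↔⊤ (⊤↔singleton (none (suc s)) none-unique)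
Fin[C]↔Combination (suc s) (suc u) =
  Fin (suc s C suc u)                        ↔⟨ K-reflexive (cong Fin (sym (nCk+nC[k+1]≡[n+1]C[k+1] s u))) ⟩
  Fin (s C u + s C suc u)                    ↔⟨ +↔⊎ ⟩
  (Fin (s C u) ⊎ Fin (s C suc u))            ↔⟨ Fin[C]↔Combination s u ⊎-↔ Fin[C]↔Combination s (suc u) ⟩
  (Combination s u ⊎ Combination s (suc u))  ↔⟨ mk↔ₛ′ [ take , skip ]′ split join∘split split∘join ⟩
  Combination (suc s) (suc u)                ∎
  where
  open EquationalReasoning
  split : Combination (suc s) (suc u) → Combination s u ⊎ Combination s (suc u)
  split (take c) = inj₁ c
  split (skip c) = inj₂ c
  join∘split : ∀ c → [ take , skip ]′ (split c) ≡ c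
  join∘split (take c) = refl
  join∘split (skip c) = refl
  split∘join : ∀ c → split ([ take , skip ]′ c) ≡ c
  split∘join (inj₁ c) = refl
  split∘join (inj₂ c) = refl

Fin[2^n]↔Combination : ∀ n → Fin (2 ^ n) ↔ Σ ℕ (Combination n)
Fin[2^n]↔Combination zero    = ↔-trans 1↔⊤ (⊤↔singleton (0 , []) λ { (0 , []) → refl })
Fin[2^n]↔Combination (suc n) =
  Fin (2 * 2 ^ n)                ↔⟨ *↔× ⟩
  (Fin 2 × Fin (2 ^ n))          ↔⟨ ↔-refl ×-↔ Fin[2^n]↔Combination n ⟩
  (Fin 2 × Σ ℕ (Combination n))  ↔⟨ mk↔ₛ′ extend restrict extend∘restrict restrict∘extend ⟩
  Σ ℕ (Combination (suc n))      ∎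
  where
  open EquationalReasoning
  extend : Fin 2 × Σ ℕ (Combination n) → Σ ℕ (Combination (suc n))
  extend (zero     , u , c) = u , skip c
  extend (suc zero , u , c) = suc u , take c
  restrict : Σ ℕ (Combination (suc n)) → Fin 2 × Σ ℕ (Combination n)
  restrict (u     , skip c) = zero , u , c
  restrict (suc u , take c) = suc zero , u , c
  extend∘restrict : ∀ x → extend (restrict x) ≡ x
  extend∘restrict (u     , skip c) = refl
  extend∘restrict (suc u , take c) = refl
  restrict∘extend : ∀ x → restrict (extend x) ≡ x
  restrict∘extend (zero     , _) = refl
  restrict∘extend (suc zero , _) = refl

Fin↔Combination×Combination : ∀ s t u → Fin ((s C u) * (t C u)) ↔ (Combination s u × Combination t u)
Fin↔Combination×Combination s t u = ↔-trans *↔× (Fin[C]↔Combination s u ×-↔ Fin[C]↔Combination t u)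

module _ where
  open import Data.Nat.DivMod using (_/_; m/n*n≡m; *-/-assoc; /-congʳ)
  open import Data.Nat.Divisibility using (_∣_; m≤n⇒m!∣n!)
  open import Data.Nat.Combinatorics using (_P_; nCk≡nPk/k!; k>n⇒nCk≡0; k>n⇒nPk≡0; nPk≡n!/[n∸k]!; nPn≡n!)
  open import Data.Nat.Combinatorics.Specification using (k!∣nP′k; nP′k≡n!/[n∸k]!)

  [1+t]P[1+u]≡[1+t]*[tPu] : ∀ t u → (suc t P suc u) ≡ suc t * (t P u)
  [1+t]P[1+u]≡[1+t]*[tPu] t u with u ≤? t
  ... | yes u≤t = begin
    suc t P suc u              ≡⟨ nPk≡n!/[n∸k]! (s≤s u≤t) ⟩
    suc t * t ! / (t ∸ u) !    ≡⟨ *-/-assoc (suc t) (m≤n⇒m!∣n! (m∸n≤m t u)) ⟩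
    suc t * (t ! / (t ∸ u) !)  ≡⟨ cong (suc t *_) (nPk≡n!/[n∸k]! u≤t) ⟨
    suc t * (t P u)            ∎
    where
    open ≡-Reasoning
    instance _ = (t ∸ u) !≢0
  ... | no u≰t = begin
    suc t P suc u              ≡⟨ k>n⇒nPk≡0 (s≤s (≰⇒> u≰t)) ⟩
    0                          ≡⟨ *-zeroʳ (suc t) ⟨
    suc t * 0                  ≡⟨ cong (suc t *_) (k>n⇒nPk≡0 (≰⇒> u≰t)) ⟨
    suc t * (t P u)            ∎
    where open ≡-Reasoning

  Fin[P]↔Arrangement : ∀ t u → Fin (t P u) ↔ Arrangement t u
  Fin[P]↔Arrangement t       zero    = ↔-trans 1↔⊤ (⊤↔singleton [] λ { [] → refl })
  Fin[P]↔Arrangement zero    (suc u) = ↔-trans 0↔⊥ (mk↔ₛ′ (λ ()) (λ ()) (λ ()) (λ ()))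
  Fin[P]↔Arrangement (suc t) (suc u) =
    Fin (suc t P suc u)              ↔⟨ K-reflexive (cong Fin ([1+t]P[1+u]≡[1+t]*[tPu] t u)) ⟩
    Fin (suc t * (t P u))            ↔⟨ *↔× ⟩
    (Fin (suc t) × Fin (t P u))      ↔⟨ ↔-refl ×-↔ Fin[P]↔Arrangement t u ⟩
    (Fin (suc t) × Arrangement t u)  ↔⟨ mk↔ₛ′ (λ (j , a) → j ∷ a) (λ { (j ∷ a) → j , a })
                                                 (λ { (j ∷ a) → refl }) (λ { (j , a) → refl }) ⟩
    Arrangement (suc t) (suc u)      ∎
    where open EquationalReasoning

  tCu*u!≡tPu : ∀ t u → (t C u) * u ! ≡ t P u
  tCu*u!≡tPu t u with u ≤? t
  ... | yes u≤t = begin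
    (t C u) * u !        ≡⟨ cong (_* u !) (nCk≡nPk/k! u≤t) ⟩
    (t P u) / u ! * u !  ≡⟨ m/n*n≡m u!∣tPu ⟩
    t P u                ∎
    where
    open ≡-Reasoning
    instance _ = u !≢0
    instance _ = (t ∸ u) !≢0
    u!∣tPu : u ! ∣ t P u
    u!∣tPu = subst (u ! ∣_) (trans (nP′k≡n!/[n∸k]! u≤t) (sym (nPk≡n!/[n∸k]! u≤t))) (k!∣nP′k u≤t)
  ... | no u≰t = begin
    (t C u) * u !        ≡⟨ cong (_* u !) (k>n⇒nCk≡0 (≰⇒> u≰t)) ⟩
    0                    ≡⟨ k>n⇒nPk≡0 (≰⇒> u≰t) ⟨
    t P u                ∎
    where open ≡-Reasoning

  n!/k!≡nP[n∸k] : ∀ {n k} → k ≤ n → (n ! / k !) {{k !≢0}} ≡ n P (n ∸ k)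
  n!/k!≡nP[n∸k] {n} {k} k≤n = begin
    n ! / k !              ≡⟨ /-congʳ (cong _! (m∸[m∸n]≡n k≤n)) ⟨
    n ! / (n ∸ (n ∸ k)) !  ≡⟨ nPk≡n!/[n∸k]! (m∸n≤m n k) ⟨
    n P (n ∸ k)            ∎
    where
    open ≡-Reasoning
    instance _ = k !≢0
    instance _ = (n ∸ (n ∸ k)) !≢0

  Fin↔Combination×Arrangement : ∀ s t u → Fin ((s C u) * (t C u) * u !) ↔ (Combination s u × Arrangement t u)
  Fin↔Combination×Arrangement s t u =
    ↔-trans (K-reflexive (cong Fin count)) (↔-trans *↔× (Fin[C]↔Combination s u ×-↔ Fin[P]↔Arrangement t u))
    where
    count : (s C u) * (t C u) * u ! ≡ (s C u) * (t P u)
    count = trans (*-assoc (s C u) (t C u) (u !)) (cong ((s C u) *_) (tCu*u!≡tPu t u))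

  Fin[n!/k!]↔Arrangement : ∀ {n k} → k ≤ n → Fin ((n ! / k !) {{k !≢0}}) ↔ Arrangement n (n ∸ k)
  Fin[n!/k!]↔Arrangement {n} {k} k≤n =
    ↔-trans (K-reflexive (cong Fin (n!/k!≡nP[n∸k] k≤n))) (Fin[P]↔Arrangement n (n ∸ k))

  Fin[n!/k!]↔Combination×Arrangement : ∀ {n k} → k ≤ n →
    Fin ((n ! / k !) {{k !≢0}}) ↔ (Combination n (n ∸ k) × Arrangement (n ∸ k) (n ∸ k))
  Fin[n!/k!]↔Combination×Arrangement {n} {k} k≤n =
    ↔-trans (K-reflexive (cong Fin count))
      (↔-trans *↔× (Fin[C]↔Combination n (n ∸ k) ×-↔ Fin[P]↔Arrangement (n ∸ k) (n ∸ k)))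
    where
    count : (n ! / k !) {{k !≢0}} ≡ (n C (n ∸ k)) * ((n ∸ k) P (n ∸ k))
    count = begin
      (n ! / k !) {{k !≢0}}                ≡⟨ n!/k!≡nP[n∸k] k≤n ⟩
      n P (n ∸ k)                          ≡⟨ tCu*u!≡tPu n (n ∸ k) ⟨
      (n C (n ∸ k)) * (n ∸ k) !            ≡⟨ cong ((n C (n ∸ k)) *_) (nPn≡n! (n ∸ k)) ⟨
      (n C (n ∸ k)) * ((n ∸ k) P (n ∸ k))  ∎
      where open ≡-Reasoning

Below : ℕ → Set
Below m = [ j ∈ ℕ ∣ j ℕ.< m ]

Between : ℕ → ℕ → Set
Between a b = [ k ∈ ℕ ∣ a ≤ k × k ≤ b ]

Σ-Below-suc : (F : ℕ → Set) → (F 0 ⊎ Σ[ j ∈ Below m ] F (suc (value j))) ↔ (Σ[ j ∈ Below (suc m) ] F (value j))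
Σ-Below-suc {m} F = mk↔ₛ′ to from to∘from from∘to
  where
  to : F 0 ⊎ Σ[ j ∈ Below m ] F (suc (value j)) → Σ[ j ∈ Below (suc m) ] F (value j)
  to (inj₁ x)                 = (0 , [ s≤s z≤n ]) , x
  to (inj₂ ((j , [ p ]) , x)) = (suc j , [ s≤s p ]) , x
  from : Σ[ j ∈ Below (suc m) ] F (value j) → F 0 ⊎ Σ[ j ∈ Below m ] F (suc (value j))
  from ((zero  , _)     , x) = inj₁ x
  from ((suc j , [ p ]) , x) = inj₂ ((j , [ s≤s⁻¹ p ]) , x)
  to∘from : ∀ y → to (from y) ≡ y
  to∘from ((zero  , _) , x) = refl
  to∘from ((suc j , _) , x) = refl
  from∘to : ∀ x → from (to x) ≡ x
  from∘to (inj₁ _) = refl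
  from∘to (inj₂ _) = refl

Fin-sum↔Σ : ∀ m (h f : ℕ → ℕ) → Fin (sum (map f (applyUpTo h m))) ↔ (Σ[ j ∈ Below m ] Fin (f (h (value j))))
Fin-sum↔Σ zero    h f = mk↔ₛ′ (λ ()) (λ { ((_ , [ p ]) , _) → ⊥-elim-irr (n≮0 p) })
                                 (λ { ((_ , [ p ]) , _) → ⊥-elim-irr (n≮0 p) }) (λ ())
Fin-sum↔Σ (suc m) h f =
  ↔-trans +↔⊎ (↔-trans (↔-refl ⊎-↔ Fin-sum↔Σ m (h ∘ suc) f) (Σ-Below-suc (λ j → Fin (f (h j)))))

j<1+b∸a⇒a+j≤b : ∀ a b j → j ℕ.< suc b ∸ a → a + j ≤ b
j<1+b∸a⇒a+j≤b zero    b       j j<1+b   = s≤s⁻¹ j<1+b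
j<1+b∸a⇒a+j≤b (suc a) zero    j j<1∸a   = contradiction (subst (j ℕ.<_) (0∸n≡0 a) j<1∸a) n≮0
j<1+b∸a⇒a+j≤b (suc a) (suc b) j j<1+b∸a = s≤s (j<1+b∸a⇒a+j≤b a b j j<1+b∸a)

Below↔Between : ∀ a b → Below (suc b ∸ a) ↔ Between a b
Below↔Between a b = mk↔ₛ′ to from to∘from from∘to
  where
  to : Below (suc b ∸ a) → Between a b
  to (j , [ p ]) = a + j , [ m≤m+n a j , j<1+b∸a⇒a+j≤b a b j p ]
  from : Between a b → Below (suc b ∸ a)
  from (k , [ p ]) = k ∸ a , [ ∸-monoˡ-< (s≤s (proj₂ p)) (proj₁ p) ]
  to∘from : ∀ k → to (from k) ≡ k
  to∘from (k , [ p ]) = value-injective (m+[n∸m]≡n (recompute (a ≤? k) (proj₁ p)))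
  from∘to : ∀ j → from (to j) ≡ j
  from∘to (j , _) = value-injective (m+n∸m≡n a j)

Fin-sumFromTo↔Σ : ∀ a b f → Fin (sumFromTo a b f) ↔ (Σ[ k ∈ Between a b ] Fin (f (value k)))
Fin-sumFromTo↔Σ a b f =
  ↔-trans (Fin-sum↔Σ (suc b ∸ a) id (λ j → f (a + j))) (Σ-↔ (Below↔Between a b) ↔-refl)

reverse : Between 0 n ↔ Between 0 n
reverse {n} = mk↔ₛ′ flip flip flip∘flip flip∘flip
  where
  flip : Between 0 n → Between 0 n
  flip (k , _) = n ∸ k , [ z≤n , m∸n≤m n k ]
  flip∘flip : ∀ k → flip (flip k) ≡ k
  flip∘flip (k , [ p ]) = value-injective (m∸[m∸n]≡n (recompute (k ≤? n) (proj₂ p)))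

-- Layouts

-- The points of a layout are listed from 0. In `both j L` the new point 0 is source 0 and target j;
-- the other targets are those of L, renumbered by `punchIn j`.
data Layout : ℕ → ℕ → ℕ → Set where
  []     : Layout 0 0 0
  free   : Layout n s t → Layout (suc n) s t
  source : Layout n s t → Layout (suc n) (suc s) t
  target : Layout n s t → Layout (suc n) s (suc t)
  both   : Fin (suc t) → Layout n s t → Layout (suc n) (suc s) (suc t)

zeroAt : Fin (suc t) → (Fin t → Fin n) → Fin (suc t) → Fin (suc n)
zeroAt j f k with j ≟ k
... | yes _   = zero
... | no j≢k = suc (f (punchOut j≢k))

module _ (j : Fin (suc t)) (f : Fin t → Fin n) where

  zeroAt-at : zeroAt j f j ≡ zero
  zeroAt-at with j ≟ j
  ... | yes _   = refl
  ... | no j≢j = contradiction refl j≢j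

  zeroAt-≢ : ∀ {k} (j≢k : j ≢ k) → zeroAt j f k ≡ suc (f (punchOut j≢k))
  zeroAt-≢ {k} j≢k with j ≟ k
  ... | yes j≡k = contradiction j≡k j≢k
  ... | no _    = cong (suc ∘ f) (punchOut-cong j refl)

  zeroAt-punchIn : ∀ k → zeroAt j f (punchIn j k) ≡ suc (f k)
  zeroAt-punchIn k = trans (zeroAt-≢ (punchInᵢ≢i j k ∘ sym)) (cong (suc ∘ f) (punchOut-punchIn j))

  zeroAt≡zero : ∀ {k} → zeroAt j f k ≡ zero → j ≡ k
  zeroAt≡zero {k} e with j ≟ k
  ... | yes j≡k = j≡k
  zeroAt≡zero {k} () | no _

  zeroAt-injective : Injective _≡_ _≡_ f → Injective _≡_ _≡_ (zeroAt j f)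
  zeroAt-injective f-inj {k} {k′} e with j ≟ k | j ≟ k′
  ... | yes j≡k | yes j≡k′ = trans (sym j≡k) j≡k′
  ... | yes _   | no j≢k′ = contradiction (sym e) λ ()
  ... | no j≢k  | yes _   = contradiction e λ ()
  ... | no j≢k  | no j≢k′ = punchOut-injective j≢k j≢k′ (f-inj (suc-injective e))

sourceMap : Layout n s t → Fin s → Fin n
sourceMap (free L)   i       = suc (sourceMap L i)
sourceMap (source L) zero    = zero
sourceMap (source L) (suc i) = suc (sourceMap L i)
sourceMap (target L) i       = suc (sourceMap L i)
sourceMap (both _ L) zero    = zero
sourceMap (both _ L) (suc i) = suc (sourceMap L i)

targetMap : Layout n s t → Fin t → Fin n
targetMap (free L)   j       = suc (targetMap L j)
targetMap (source L) j       = suc (targetMap L j)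
targetMap (target L) zero    = zero
targetMap (target L) (suc j) = suc (targetMap L j)
targetMap (both j L)         = zeroAt j (targetMap L)

sourceMap-injective : (L : Layout n s t) → Injective _≡_ _≡_ (sourceMap L)
sourceMap-injective (free L)   e                 = sourceMap-injective L (suc-injective e)
sourceMap-injective (source L) {zero}  {zero}  _ = refl
sourceMap-injective (source L) {suc _} {suc _} e = cong suc (sourceMap-injective L (suc-injective e))
sourceMap-injective (target L) e                 = sourceMap-injective L (suc-injective e)
sourceMap-injective (both _ L) {zero}  {zero}  _ = refl
sourceMap-injective (both _ L) {suc _} {suc _} e = cong suc (sourceMap-injective L (suc-injective e))

targetMap-injective : (L : Layout n s t) → Injective _≡_ _≡_ (targetMap L)
targetMap-injective (free L)   e                 = targetMap-injective L (suc-injective e)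
targetMap-injective (source L) e                 = targetMap-injective L (suc-injective e)
targetMap-injective (target L) {zero}  {zero}  _ = refl
targetMap-injective (target L) {suc _} {suc _} e = cong suc (targetMap-injective L (suc-injective e))
targetMap-injective (both j L)                   = zeroAt-injective j (targetMap L) (targetMap-injective L)

discreteIposet : (σ : Fin s → Fin n) (τ : Fin t → Fin n) → Injective _≡_ _≡_ σ → Injective _≡_ _≡_ τ → Iposet s t
discreteIposet {n = n} σ τ σ-inj τ-inj = record
  { Carrier = Fin n
  ; _≺_     = λ _ _ → ⊥
  ; irrefl  = λ _ ()
  ; trans   = λ ()
  ; points  = n
  ; enum    = mk↔ₛ′ id id (λ _ → refl) (λ _ → refl)
  ; src     = σ
  ; tgt     = τ
  ; src-inj = σ-inj
  ; tgt-inj = τ-inj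
  ; src-min = λ _ _ ()
  ; tgt-max = λ _ _ ()
  }

⟦_⟧ : Layout n s t → Iposet s t
⟦ L ⟧ = discreteIposet (sourceMap L) (targetMap L) (sourceMap-injective L) (targetMap-injective L)

Matching : ℕ → ℕ → ℕ → Set
Matching s t u = Combination s u × Arrangement t u

MonotoneMatching : ℕ → ℕ → ℕ → Set
MonotoneMatching s t u = Combination s u × Combination t u

-- A code for an iposet s → t on n points: a matching of `matched` sources with targets, such that
-- the s + t − matched distinct interface points fit into the n points.
record Code (Match : ℕ → ℕ → ℕ → Set) (n s t : ℕ) : Set where
  constructor code
  field
    {matched} : ℕ
    match     : Match s t matched
    .fits     : s + t ≤ n + matched

fits-both-pred : suc s + suc t ≤ suc n + suc u → s + t ≤ n + u
fits-both-pred {s} {t} {n} {u} fits = s≤s⁻¹ (subst₂ _≤_ (+-suc s t) (+-suc n u) (s≤s⁻¹ fits))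

fits-target-pred : s + suc t ≤ suc n + u → s + t ≤ n + u
fits-target-pred {s} {t} {n} {u} fits = s≤s⁻¹ (subst (_≤ suc n + u) (+-suc s t) fits)

fits-both-suc : s + t ≤ n + u → suc s + suc t ≤ suc n + suc u
fits-both-suc {s} {t} {n} {u} fits = s≤s (subst₂ _≤_ (sym (+-suc s t)) (sym (+-suc n u)) (s≤s fits))

fits-target-suc : s + t ≤ n + u → s + suc t ≤ suc n + u
fits-target-suc {s} {t} {n} {u} fits = subst (_≤ suc n + u) (sym (+-suc s t)) (s≤s fits)

no-room : u ≤ s → ¬ (s + suc t ≤ u)
no-room {u} {s} {t} u≤s fits = ≤⇒≯ u≤s (m+n≤o⇒m≤o (suc s) (subst (_≤ u) (+-suc s t) fits))

no-room-source : u ≤ s → ¬ (suc s + t ≤ u)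
no-room-source {s = s} u≤s fits = ≤⇒≯ u≤s (m+n≤o⇒m≤o (suc s) fits)

frees : ∀ n → Layout n 0 0
frees zero    = []
frees (suc n) = free (frees n)

targetsThenFrees : ∀ t n → .(t ≤ n) → Layout n 0 t
targetsThenFrees zero    n       _   = frees n
targetsThenFrees (suc t) zero    t≤0 = ⊥-elim-irr (n≮0 t≤0)
targetsThenFrees (suc t) (suc n) t≤n = target (targetsThenFrees t n (s≤s⁻¹ t≤n))

layoutOf : Combination s u → Arrangement t u → ∀ n → .(s + t ≤ n + u) → Layout n s t
layoutOf []       []      n       fits = targetsThenFrees _ n (subst (_≤_ _) (+-identityʳ n) fits)
layoutOf (skip S) I       zero    fits = ⊥-elim-irr (no-room-source (combination-≤ S) fits)
layoutOf (skip S) I       (suc n) fits = source (layoutOf S I n (s≤s⁻¹ fits))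
layoutOf (take S) (j ∷ I) zero    fits = ⊥-elim-irr (no-room (combination-≤ S) (s≤s⁻¹ fits))
layoutOf (take S) (j ∷ I) (suc n) fits = both j (layoutOf S I n (fits-both-pred fits))

-- The first target if it is unmatched, else the first source if it is unmatched, else the pair
-- formed by both; free points last.
monotoneLayoutOf : Combination s u → Combination t u → ∀ n → .(s + t ≤ n + u) → Layout n s t
monotoneLayoutOf S        (skip T) zero    fits = ⊥-elim-irr (no-room (combination-≤ S) fits)
monotoneLayoutOf S        (skip T) (suc n) fits = target (monotoneLayoutOf S T n (fits-target-pred {n = n} fits))
monotoneLayoutOf []       []       n       _    = frees n
monotoneLayoutOf (skip S) []       zero    fits = ⊥-elim-irr (no-room-source (combination-≤ S) fits)
monotoneLayoutOf (skip S) []       (suc n) fits = source (monotoneLayoutOf S [] n (s≤s⁻¹ fits))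
monotoneLayoutOf (skip S) (take T) zero    fits = ⊥-elim-irr (no-room-source (combination-≤ S) fits)
monotoneLayoutOf (skip S) (take T) (suc n) fits = source (monotoneLayoutOf S (take T) n (s≤s⁻¹ fits))
monotoneLayoutOf (take S) (take T) zero    fits = ⊥-elim-irr (no-room (combination-≤ S) (s≤s⁻¹ fits))
monotoneLayoutOf (take S) (take T) (suc n) fits = both zero (monotoneLayoutOf S T n (fits-both-pred fits))

layout : Code Matching n s t → Layout n s t
layout {n = n} (code (S , I) fits) = layoutOf S I n fits

monotoneLayout : Code MonotoneMatching n s t → Layout n s t
monotoneLayout {n = n} (code (S , T) fits) = monotoneLayoutOf S T n fits

SameMatching : Layout n s t → Layout n′ s t → Set
SameMatching L L′ = ∀ i j → (sourceMap L i ≡ targetMap L j) ⇔ (sourceMap L′ i ≡ targetMap L′ j)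

sameMatching-suc : {L : Layout (suc n) s t} {L′ : Layout (suc n′) s t} → SameMatching L L′ →
  ∀ {i j a b a′ b′} → sourceMap L i ≡ suc a → targetMap L j ≡ suc b →
  sourceMap L′ i ≡ suc a′ → targetMap L′ j ≡ suc b′ → (a ≡ b) ⇔ (a′ ≡ b′)
sameMatching-suc r {i} {j} ea eb ea′ eb′ = mk⇔
  (λ e → suc-injective (trans (sym ea′) (trans (Equivalence.to   (r i j) (trans ea (trans (cong suc e) (sym eb))))  eb′)))
  (λ e → suc-injective (trans (sym ea)  (trans (Equivalence.from (r i j) (trans ea′ (trans (cong suc e) (sym eb′)))) eb)))

module _ {L : Layout n s t} {L′ : Layout n′ s t} where

  sameMatching-source : SameMatching (source L) (source L′) → SameMatching L L′
  sameMatching-source r i j = sameMatching-suc {L = source L} {source L′} r {suc i} {j} refl refl refl refl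

  sameMatching-target : SameMatching (target L) (target L′) → SameMatching L L′
  sameMatching-target r i j = sameMatching-suc {L = target L} {target L′} r {i} {suc j} refl refl refl refl

  sameMatching-both : ∀ x → SameMatching (both x L) (both x L′) → SameMatching L L′
  sameMatching-both x r i j =
    sameMatching-suc {L = both x L} {both x L′} r {suc i} {punchIn x j} refl (zeroAt-punchIn x _ j) refl (zeroAt-punchIn x _ j)

layoutOf-injective : ∀ {n u u′} (S : Combination s u) (I : Arrangement t u) (S′ : Combination s u′) (I′ : Arrangement t u′)
  .(fits : s + t ≤ n + u) .(fits′ : s + t ≤ n + u′) →
  SameMatching (layoutOf S I n fits) (layoutOf S′ I′ n fits′) → _≡_ {A = Σ ℕ (Matching s t)} (u , S , I) (u′ , S′ , I′)
layoutOf-injective []       []      []        []       _ _ _ = refl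
layoutOf-injective {n = zero} (skip S) I       _ _ fits _ _ = ⊥-elim-irr (no-room-source (combination-≤ S) fits)
layoutOf-injective {n = zero} (take S) (j ∷ I) _ _ fits _ _ = ⊥-elim-irr (no-room (combination-≤ S) (s≤s⁻¹ fits))
layoutOf-injective {n = suc n} (skip S) I      (skip S′) I′       _ _ r =
  cong (λ { (u , S , I) → u , skip S , I }) (layoutOf-injective S I S′ I′ _ _ (sameMatching-source r))
layoutOf-injective {n = suc n} (skip S) I      (take S′) (j ∷ I′) _ _ r
  with () ← Equivalence.from (r zero j) (sym (zeroAt-at j _))
layoutOf-injective {n = suc n} (take S) (j ∷ I) (skip S′) I′      _ _ r
  with () ← Equivalence.to (r zero j) (sym (zeroAt-at j _))
-- Source 0 is target j on the left, hence also on the right, where it is target j′.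
layoutOf-injective {n = suc n} (take S) (j ∷ I) (take S′) (j′ ∷ I′) _ _ r
  with refl ← zeroAt≡zero j′ _ (sym (Equivalence.to (r zero j) (sym (zeroAt-at j _)))) =
  cong (λ { (u , S , I) → suc u , take S , j ∷ I }) (layoutOf-injective S I S′ I′ _ _ (sameMatching-both j r))

first-target-matched : ∀ {n u} (S : Combination s (suc u)) (T : Combination t u) .(fits : s + suc t ≤ n + suc u) →
  Σ[ i ∈ Fin s ] sourceMap (monotoneLayoutOf S (take T) n fits) i ≡ targetMap (monotoneLayoutOf S (take T) n fits) zero
first-target-matched {n = zero}  (skip S) T fits = ⊥-elim-irr (no-room-source (combination-≤ S) fits)
first-target-matched {n = zero}  (take S) T fits = ⊥-elim-irr (no-room (combination-≤ S) (s≤s⁻¹ fits))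
first-target-matched {n = suc n} (skip S) T fits =
  let i , e = first-target-matched S T (s≤s⁻¹ fits) in suc i , cong suc e
first-target-matched {n = suc n} (take S) T fits = zero , refl

monotoneLayoutOf-injective : ∀ {n u u′} (S : Combination s u) (T : Combination t u)
  (S′ : Combination s u′) (T′ : Combination t u′)
  .(fits : s + t ≤ n + u) .(fits′ : s + t ≤ n + u′) →
  SameMatching (monotoneLayoutOf S T n fits) (monotoneLayoutOf S′ T′ n fits′) →
  _≡_ {A = Σ ℕ (MonotoneMatching s t)} (u , S , T) (u′ , S′ , T′)
monotoneLayoutOf-injective S [] S′ [] _ _ _ = cong (λ S → 0 , S , []) (trans (none-unique S) (sym (none-unique S′)))
monotoneLayoutOf-injective {n = zero} S (skip T) _ _ fits _ _ = ⊥-elim-irr (no-room (combination-≤ S) fits)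
monotoneLayoutOf-injective {n = zero} S (take T) (skip S′) _ _ fits′ _ = ⊥-elim-irr (no-room-source (combination-≤ S′) fits′)
monotoneLayoutOf-injective {n = zero} S (take T) (take S′) _ _ fits′ _ =
  ⊥-elim-irr (no-room (combination-≤ S′) (s≤s⁻¹ fits′))
monotoneLayoutOf-injective {n = suc n} S (skip T) S′ (skip T′) _ _ r =
  cong (λ { (u , S , T) → u , S , skip T }) (monotoneLayoutOf-injective S T S′ T′ _ _ (sameMatching-target r))
monotoneLayoutOf-injective {n = suc n} S (skip T) S′ (take T′) _ fits′ r
  with i , e ← first-target-matched {n = suc n} S′ T′ fits′
  with () ← Equivalence.from (r i zero) e
monotoneLayoutOf-injective {n = suc n} S (take T) S′ (skip T′) fits _ r
  with i , e ← first-target-matched {n = suc n} S T fits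
  with () ← Equivalence.to (r i zero) e
monotoneLayoutOf-injective {n = suc n} (skip S) (take T) (skip S′) (take T′) _ _ r =
  cong (λ { (u , S , T) → u , skip S , T }) (monotoneLayoutOf-injective S (take T) S′ (take T′) _ _ (sameMatching-source r))
monotoneLayoutOf-injective {n = suc n} (skip S) (take T) (take S′) (take T′) _ _ r
  with () ← Equivalence.from (r zero zero) refl
monotoneLayoutOf-injective {n = suc n} (take S) (take T) (skip S′) (take T′) _ _ r
  with () ← Equivalence.to (r zero zero) refl
monotoneLayoutOf-injective {n = suc n} (take S) (take T) (take S′) (take T′) _ _ r =
  cong (λ { (u , S , T) → suc u , take S , take T }) (monotoneLayoutOf-injective S T S′ T′ _ _ (sameMatching-both zero r))

↔-injective : ∀ {A B : Set} (f : A ↔ B) → Injective _≡_ _≡_ (Inverse.to f)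
↔-injective f = Injection.injective (↔⇒↣ f)

≅⇒sameMatching : {L : Layout n s t} {L′ : Layout n′ s t} → ⟦ L ⟧ ≅ ⟦ L′ ⟧ → SameMatching L L′
≅⇒sameMatching (f , _ , f-src , f-tgt) i j = mk⇔
  (λ e → trans (sym (f-src i)) (trans (cong (Inverse.to f) e) (f-tgt j)))
  (λ e → ↔-injective f (trans (f-src i) (trans e (sym (f-tgt j)))))

-- Every discrete iposet is a relabelled layout

Relabelling : (Fin s → Fin n) → (Fin t → Fin n) → Layout n s t → Set
Relabelling {n = n} σ τ L = Σ[ π ∈ Permutation′ n ]
  (∀ i → π ⟨$⟩ʳ σ i ≡ sourceMap L i) × (∀ j → π ⟨$⟩ʳ τ j ≡ targetMap L j)

relabelling-matches : ∀ {σ : Fin s → Fin n} {τ : Fin t → Fin n} {L} → Relabelling σ τ L →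
  ∀ {i j} → σ i ≡ τ j → sourceMap L i ≡ targetMap L j
relabelling-matches (π , π-src , π-tgt) {i} {j} e = trans (sym (π-src i)) (trans (cong (π ⟨$⟩ʳ_) e) (π-tgt j))

insert-at : (i : Fin (suc n)) (j : Fin (suc m)) (π : Permutation n m) → insert i j π ⟨$⟩ʳ i ≡ j
insert-at i j π with i ≟ i
... | yes _    = refl
... | no i≢i = contradiction refl i≢i

module _ (p : Fin (suc n)) where

  without : (f : Fin m → Fin (suc n)) → (∀ x → p ≢ f x) → Fin m → Fin n
  without f avoid x = punchOut (avoid x)

  without-injective : ∀ {f : Fin m → Fin (suc n)} avoid → Injective _≡_ _≡_ f → Injective _≡_ _≡_ (without f avoid)
  without-injective avoid f-inj e = f-inj (punchOut-injective (avoid _) (avoid _) e)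

  insert-without : ∀ (π : Permutation′ n) (f : Fin m → Fin (suc n)) avoid x →
    insert p zero π ⟨$⟩ʳ f x ≡ suc (π ⟨$⟩ʳ without f avoid x)
  insert-without π f avoid x =
    trans (cong (insert p zero π ⟨$⟩ʳ_) (sym (punchIn-punchOut (avoid x)))) (insert-punchIn p zero π _)

injective-≢ : ∀ {f : Fin m → Fin n} → Injective _≡_ _≡_ f → ∀ {x y} → x ≢ y → f x ≢ f y
injective-≢ f-inj x≢y e = x≢y (f-inj e)

head-avoids-tail : ∀ {f : Fin (suc m) → Fin n} → Injective _≡_ _≡_ f → ∀ x → f zero ≢ f (suc x)
head-avoids-tail f-inj x = injective-≢ f-inj λ ()

module _ {L : Layout n s t} where

  relabel-source : (σ : Fin (suc s) → Fin (suc n)) (τ : Fin t → Fin (suc n)) → ∀ aσ aτ →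
    Relabelling (without (σ zero) (σ ∘ suc) aσ) (without (σ zero) τ aτ) L → Relabelling σ τ (source L)
  relabel-source σ τ aσ aτ (π , π-src , π-tgt) = π′ , sources , targets
    where
    π′ : Permutation′ (suc n)
    π′ = insert (σ zero) zero π
    sources : ∀ i → π′ ⟨$⟩ʳ σ i ≡ sourceMap (source L) i
    sources zero    = insert-at (σ zero) zero π
    sources (suc i) = trans (insert-without (σ zero) π (σ ∘ suc) aσ i) (cong suc (π-src i))
    targets : ∀ j → π′ ⟨$⟩ʳ τ j ≡ targetMap (source L) j
    targets j = trans (insert-without (σ zero) π τ aτ j) (cong suc (π-tgt j))

  relabel-target : (σ : Fin s → Fin (suc n)) (τ : Fin (suc t) → Fin (suc n)) → ∀ aσ aτ →
    Relabelling (without (τ zero) σ aσ) (without (τ zero) (τ ∘ suc) aτ) L → Relabelling σ τ (target L)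
  relabel-target σ τ aσ aτ (π , π-src , π-tgt) = π′ , sources , targets
    where
    π′ : Permutation′ (suc n)
    π′ = insert (τ zero) zero π
    sources : ∀ i → π′ ⟨$⟩ʳ σ i ≡ sourceMap (target L) i
    sources i = trans (insert-without (τ zero) π σ aσ i) (cong suc (π-src i))
    targets : ∀ j → π′ ⟨$⟩ʳ τ j ≡ targetMap (target L) j
    targets zero    = insert-at (τ zero) zero π
    targets (suc j) = trans (insert-without (τ zero) π (τ ∘ suc) aτ j) (cong suc (π-tgt j))

  relabel-both : (σ : Fin (suc s) → Fin (suc n)) (τ : Fin (suc t) → Fin (suc n)) (j : Fin (suc t)) →
    τ j ≡ σ zero → ∀ aσ aτ →
    Relabelling (without (σ zero) (σ ∘ suc) aσ) (without (σ zero) (τ ∘ punchIn j) aτ) L → Relabelling σ τ (both j L)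
  relabel-both σ τ j e aσ aτ (π , π-src , π-tgt) = π′ , sources , targets
    where
    π′ : Permutation′ (suc n)
    π′ = insert (σ zero) zero π
    sources : ∀ i → π′ ⟨$⟩ʳ σ i ≡ sourceMap (both j L) i
    sources zero    = insert-at (σ zero) zero π
    sources (suc i) = trans (insert-without (σ zero) π (σ ∘ suc) aσ i) (cong suc (π-src i))
    targets : ∀ k → π′ ⟨$⟩ʳ τ k ≡ zeroAt j (targetMap L) k
    targets k with j ≟ k
    ... | yes refl = trans (cong (π′ ⟨$⟩ʳ_) e) (insert-at (σ zero) zero π)
    ... | no j≢k = begin
      π′ ⟨$⟩ʳ τ k
        ≡⟨ cong (λ x → π′ ⟨$⟩ʳ τ x) (punchIn-punchOut j≢k) ⟨
      π′ ⟨$⟩ʳ τ (punchIn j (punchOut j≢k))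
        ≡⟨ insert-without (σ zero) π (τ ∘ punchIn j) aτ (punchOut j≢k) ⟩
      suc (π ⟨$⟩ʳ without (σ zero) (τ ∘ punchIn j) aτ (punchOut j≢k))
        ≡⟨ cong suc (π-tgt (punchOut j≢k)) ⟩
      suc (targetMap L (punchOut j≢k))
        ∎
      where open ≡-Reasoning

encodeTargets : ∀ n (σ : Fin 0 → Fin n) (τ : Fin t → Fin n) → Injective _≡_ _≡_ τ →
  Σ[ t≤n ∈ t ≤ n ] Relabelling σ τ (targetsThenFrees t n t≤n)
encodeTargets {zero}  n       σ τ _     = z≤n , idₚ , (λ ()) , (λ ())
encodeTargets {suc t} zero    σ τ _     with () ← τ zero
encodeTargets {suc t} (suc n) σ τ τ-inj =
  let t≤n , ρ = encodeTargets n _ (without (τ zero) (τ ∘ suc) aτ) (without-injective (τ zero) aτ (suc-injective ∘ τ-inj))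
  in s≤s t≤n , relabel-target σ τ (λ ()) aτ ρ
  where
  aτ : ∀ j → τ zero ≢ τ (suc j)
  aτ = head-avoids-tail τ-inj

encode : ∀ n (σ : Fin s → Fin n) (τ : Fin t → Fin n) → Injective _≡_ _≡_ σ → Injective _≡_ _≡_ τ →
  Σ[ c ∈ Code Matching n s t ] Relabelling σ τ (layout c)
encode {zero} n σ τ _ τ-inj =
  let t≤n , ρ = encodeTargets n σ τ τ-inj
  in code ([] , []) (subst (_ ≤_) (sym (+-identityʳ n)) t≤n) , ρ
encode {suc s} zero    σ τ _ _ with () ← σ zero
encode {suc s} (suc n) σ τ σ-inj τ-inj with any? (λ j → τ j ≟ σ zero)
... | no unmatched =
  let code (S , I) fits , ρ = encode n _ _ (without-injective (σ zero) aσ (suc-injective ∘ σ-inj))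
                                           (without-injective (σ zero) aτ τ-inj)
  in code (skip S , I) (s≤s fits) , relabel-source σ τ aσ aτ ρ
  where
  aσ : ∀ i → σ zero ≢ σ (suc i)
  aσ = head-avoids-tail σ-inj
  aτ : ∀ j → σ zero ≢ τ j
  aτ j e = unmatched (j , sym e)
encode {suc s} {zero}  (suc n) σ τ σ-inj τ-inj | yes (() , _)
encode {suc s} {suc t} (suc n) σ τ σ-inj τ-inj | yes (j , τj≡σ0) =
  let code (S , I) fits , ρ = encode n _ _ (without-injective (σ zero) aσ (suc-injective ∘ σ-inj))
                                           (without-injective (σ zero) aτ (punchIn-injective j _ _ ∘ τ-inj))
  in code (take S , j ∷ I) (fits-both-suc fits) , relabel-both σ τ j τj≡σ0 aσ aτ ρ
  where
  aσ : ∀ i → σ zero ≢ σ (suc i)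
  aσ = head-avoids-tail σ-inj
  aτ : ∀ k → σ zero ≢ τ (punchIn j k)
  aτ k e = punchInᵢ≢i j k (τ-inj (trans (sym e) (sym τj≡σ0)))

Monotone : {X : Set} → (Fin s → X) → (Fin t → X) → Set
Monotone σ τ = ∀ {i i′ j j′} → σ i ≡ τ j → σ i′ ≡ τ j′ → i < i′ → j < j′

monotone-∘ : ∀ {s′ t′} {X : Set} {σ : Fin s → X} {τ : Fin t → X} → Monotone σ τ →
  (f : Fin s′ → Fin s) (g : Fin t′ → Fin t) →
  (∀ {i i′} → i < i′ → f i < f i′) → (∀ {j j′} → g j < g j′ → j < j′) → Monotone (σ ∘ f) (τ ∘ g)
monotone-∘ mono f g f-mono g-reflects e e′ i<i′ = g-reflects (mono e e′ (f-mono i<i′))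

monotone-without : ∀ (p : Fin (suc n)) {σ : Fin s → Fin (suc n)} {τ : Fin t → Fin (suc n)} aσ aτ →
  Monotone σ τ → Monotone (without p σ aσ) (without p τ aτ)
monotone-without p aσ aτ mono e e′ =
  mono (punchOut-injective (aσ _) (aτ _) e) (punchOut-injective (aσ _) (aτ _) e′)

first-target-unmatched : ∀ {n u} (S : Combination s u) (T : Combination t u) .(fits : s + suc t ≤ n + u) →
  ∀ i → sourceMap (monotoneLayoutOf S (skip T) n fits) i ≢ targetMap (monotoneLayoutOf S (skip T) n fits) zero
first-target-unmatched {n = zero}  S T fits = ⊥-elim-irr (no-room (combination-≤ S) fits)
first-target-unmatched {n = suc n} S T fits i ()

encodeMonotone : ∀ n (σ : Fin s → Fin n) (τ : Fin t → Fin n) →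
  Injective _≡_ _≡_ σ → Injective _≡_ _≡_ τ → Monotone σ τ →
  Σ[ c ∈ Code MonotoneMatching n s t ] Relabelling σ τ (monotoneLayout c)
encodeMonotone {zero}  {zero}  n       σ τ _ _ _ = code ([] , []) z≤n , idₚ , (λ ()) , (λ ())
encodeMonotone {suc s} {zero}  zero    σ τ _ _ _ with () ← σ zero
encodeMonotone {suc s} {zero}  (suc n) σ τ σ-inj τ-inj mono
  with encodeMonotone n (without (σ zero) (σ ∘ suc) (head-avoids-tail σ-inj)) (without (σ zero) τ (λ ()))
                        (without-injective (σ zero) _ (suc-injective ∘ σ-inj)) (λ { {()} })
                        (monotone-without (σ zero) _ (λ ()) (monotone-∘ mono suc id s≤s id))
... | code (S , []) fits , ρ = code (skip S , []) (s≤s fits) , relabel-source σ τ _ (λ ()) ρ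
encodeMonotone {s}     {suc t} zero    σ τ _ _ _ with () ← τ zero
encodeMonotone {s}     {suc t} (suc n) σ τ σ-inj τ-inj mono with any? (λ i → σ i ≟ τ zero)
... | no unmatched =
  let code (S , T) fits , ρ = encodeMonotone n _ _ (without-injective (τ zero) aσ σ-inj)
                                (without-injective (τ zero) aτ (suc-injective ∘ τ-inj))
                                (monotone-without (τ zero) aσ aτ (monotone-∘ mono id suc id s≤s⁻¹))
  in code (S , skip T) (fits-target-suc {n = n} fits) , relabel-target σ τ aσ aτ ρ
  where
  aσ : ∀ i → τ zero ≢ σ i
  aσ i e = unmatched (i , sym e)
  aτ : ∀ j → τ zero ≢ τ (suc j)
  aτ = head-avoids-tail τ-inj
encodeMonotone {zero}  {suc t} (suc n) σ τ σ-inj τ-inj mono | yes (() , _)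
encodeMonotone {suc s} {suc t} (suc n) σ τ σ-inj τ-inj mono | yes (zero , σ0≡τ0) =
  let code (S , T) fits , ρ = encodeMonotone n _ _ (without-injective (σ zero) aσ (suc-injective ∘ σ-inj))
                                (without-injective (σ zero) aτ (suc-injective ∘ τ-inj))
                                (monotone-without (σ zero) aσ aτ (monotone-∘ mono suc suc s≤s s≤s⁻¹))
  in code (take S , take T) (fits-both-suc fits) , relabel-both σ τ zero (sym σ0≡τ0) aσ aτ ρ
  where
  aσ : ∀ i → σ zero ≢ σ (suc i)
  aσ = head-avoids-tail σ-inj
  aτ : ∀ j → σ zero ≢ τ (suc j)
  aτ j e = injective-≢ τ-inj (λ ()) (trans (sym σ0≡τ0) e)
-- Target 0 is matched with source suc i, so by monotonicity source 0 is unmatched; the code of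
-- the rest must then match target 0 as well.
encodeMonotone {suc s} {suc t} (suc n) σ τ σ-inj τ-inj mono | yes (suc i , σi≡τ0)
  with encodeMonotone n _ _ (without-injective (σ zero) (head-avoids-tail σ-inj) (suc-injective ∘ σ-inj))
                            (without-injective (σ zero) aτ τ-inj)
                            (monotone-without (σ zero) _ aτ (monotone-∘ mono suc id s≤s id))
  where
  aτ : ∀ j → σ zero ≢ τ j
  aτ j e with () ← mono e σi≡τ0 (s≤s z≤n)
... | code (S , take T) fits , ρ = code (skip S , take T) (s≤s fits) , relabel-source σ τ _ _ ρ
... | code (S , skip T) fits , ρ =
  contradiction (relabelling-matches ρ (punchOut-cong (σ zero) σi≡τ0)) (first-target-unmatched S T fits i)

-- Gluing-parallel discrete iposets have monotone codes

Ordered : Layout n s t → Set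
Ordered []         = ⊤
Ordered (free L)   = Ordered L
Ordered (source L) = Ordered L
Ordered (target L) = Ordered L
Ordered (both j L) = j ≡ zero × Ordered L

frees-ordered : ∀ n → Ordered (frees n)
frees-ordered zero    = tt
frees-ordered (suc n) = frees-ordered n

monotoneLayoutOf-ordered : ∀ {n u} (S : Combination s u) (T : Combination t u) .(fits : s + t ≤ n + u) →
  Ordered (monotoneLayoutOf S T n fits)
monotoneLayoutOf-ordered {n = zero}  S        (skip T) fits = ⊥-elim-irr (no-room (combination-≤ S) fits)
monotoneLayoutOf-ordered {n = suc n} S        (skip T) fits = monotoneLayoutOf-ordered S T (fits-target-pred {n = n} fits)
monotoneLayoutOf-ordered {n = n}     []       []       fits = frees-ordered n
monotoneLayoutOf-ordered {n = zero}  (skip S) []       fits = ⊥-elim-irr (no-room-source (combination-≤ S) fits)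
monotoneLayoutOf-ordered {n = suc n} (skip S) []       fits = monotoneLayoutOf-ordered S [] (s≤s⁻¹ fits)
monotoneLayoutOf-ordered {n = zero}  (skip S) (take T) fits = ⊥-elim-irr (no-room-source (combination-≤ S) fits)
monotoneLayoutOf-ordered {n = suc n} (skip S) (take T) fits = monotoneLayoutOf-ordered S (take T) (s≤s⁻¹ fits)
monotoneLayoutOf-ordered {n = zero}  (take S) (take T) fits = ⊥-elim-irr (no-room (combination-≤ S) (s≤s⁻¹ fits))
monotoneLayoutOf-ordered {n = suc n} (take S) (take T) fits = refl , monotoneLayoutOf-ordered S T (fits-both-pred fits)

discrete-parallel-order : ∀ {a b a′ b′} {n′} (L : Layout n a b) (L′ : Layout n′ a′ b′) →
  ∀ x y → ParOrd ⟦ L ⟧ ⟦ L′ ⟧ x y ⇔ ⊥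
discrete-parallel-order L L′ (inj₁ _) (inj₁ _) = mk⇔ id id
discrete-parallel-order L L′ (inj₁ _) (inj₂ _) = mk⇔ id id
discrete-parallel-order L L′ (inj₂ _) (inj₁ _) = mk⇔ id id
discrete-parallel-order L L′ (inj₂ _) (inj₂ _) = mk⇔ id id

prepend-point : ∀ {a b} (P : Layout 1 a b) (L : Layout n s t) (Q : Layout (suc n) (a + s) (b + t)) → a ≤ 1 → b ≤ 1 →
  (∀ i → join 1 n (parSrc ⟦ P ⟧ ⟦ L ⟧ i) ≡ sourceMap Q i) →
  (∀ j → join 1 n (parTgt ⟦ P ⟧ ⟦ L ⟧ j) ≡ targetMap Q j) →
  GP ⟦ L ⟧ → GP ⟦ Q ⟧
prepend-point P L Q a≤1 b≤1 sources targets gp =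
  gp-par ⟦ Q ⟧ (gp-one ⟦ P ⟧ a≤1 b≤1 refl) gp (↔-sym +↔⊎ , discrete-parallel-order P L , sources , targets)

-- ⟦ ℓ L ⟧ is the parallel composition of the one-point ⟦ ℓ [] ⟧ with ⟦ L ⟧ for each letter ℓ; for
-- `both j` this needs j ≡ zero, as parallel composition keeps the targets of ⟦ L ⟧ after the new one.
ordered⇒GP : (L : Layout n s t) → Ordered L → GP ⟦ L ⟧
ordered⇒GP []            _        = gp-empty ⟦ [] ⟧ refl
ordered⇒GP (free L)      o        =
  prepend-point (free []) L (free L) z≤n z≤n (λ _ → refl) (λ _ → refl) (ordered⇒GP L o)
ordered⇒GP (source L)    o        =
  prepend-point (source []) L (source L) ≤-refl z≤n (λ { zero → refl ; (suc _) → refl }) (λ _ → refl) (ordered⇒GP L o)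
ordered⇒GP (target L)    o        =
  prepend-point (target []) L (target L) z≤n ≤-refl (λ _ → refl) (λ { zero → refl ; (suc _) → refl }) (ordered⇒GP L o)
ordered⇒GP (both j L)    (refl , o) =
  prepend-point (both zero []) L (both zero L) ≤-refl ≤-refl
    (λ { zero → refl ; (suc _) → refl }) (λ { zero → refl ; (suc _) → refl }) (ordered⇒GP L o)

monotone-injective : ∀ {X Y : Set} {h : X → Y} {σ : Fin s → X} {τ : Fin t → X} →
  Injective _≡_ _≡_ h → Monotone σ τ → Monotone (h ∘ σ) (h ∘ τ)
monotone-injective h-inj mono e e′ = mono (h-inj e) (h-inj e′)

data SplitView (m k : ℕ) : Fin (m + k) → Set where
  left  : (a : Fin m) → SplitView m k (a ↑ˡ k)
  right : (b : Fin k) → SplitView m k (m ↑ʳ b)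

splitView : ∀ m k x → SplitView m k x
splitView m k x with splitAt m x in eq
... | inj₁ a = subst (SplitView m k) (splitAt⁻¹-↑ˡ eq) (left a)
... | inj₂ b = subst (SplitView m k) (splitAt⁻¹-↑ʳ eq) (right b)

module _ {m k : ℕ} where

  ↑ˡ-<-↑ˡ : {a a′ : Fin m} → (a ↑ˡ k < a′ ↑ˡ k) ⇔ (a < a′)
  ↑ˡ-<-↑ˡ {a} {a′} = mk⇔ (subst₂ ℕ._<_ (toℕ-↑ˡ a k) (toℕ-↑ˡ a′ k))
                          (subst₂ ℕ._<_ (sym (toℕ-↑ˡ a k)) (sym (toℕ-↑ˡ a′ k)))

  ↑ʳ-<-↑ʳ : {b b′ : Fin k} → (m ↑ʳ b < m ↑ʳ b′) ⇔ (b < b′)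
  ↑ʳ-<-↑ʳ {b} {b′} = mk⇔ (+-cancelˡ-< m _ _ ∘ subst₂ ℕ._<_ (toℕ-↑ʳ m b) (toℕ-↑ʳ m b′))
                          (subst₂ ℕ._<_ (sym (toℕ-↑ʳ m b)) (sym (toℕ-↑ʳ m b′)) ∘ +-monoʳ-< m)

  ↑ˡ<↑ʳ : (a : Fin m) (b : Fin k) → a ↑ˡ k < m ↑ʳ b
  ↑ˡ<↑ʳ a b = subst₂ ℕ._<_ (sym (toℕ-↑ˡ a k)) (sym (toℕ-↑ʳ m b)) (<-≤-trans (toℕ<n a) (m≤m+n m (toℕ b)))

module _ {n₁ m₁ n₂ m₂} (P₁ : Iposet n₁ m₁) (P₂ : Iposet n₂ m₂) where

  parSrc-↑ˡ : ∀ a → parSrc P₁ P₂ (a ↑ˡ n₂) ≡ inj₁ (src P₁ a)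
  parSrc-↑ˡ a = cong [ inj₁ ∘ src P₁ , inj₂ ∘ src P₂ ]′ (splitAt-↑ˡ n₁ a n₂)

  parSrc-↑ʳ : ∀ b → parSrc P₁ P₂ (n₁ ↑ʳ b) ≡ inj₂ (src P₂ b)
  parSrc-↑ʳ b = cong [ inj₁ ∘ src P₁ , inj₂ ∘ src P₂ ]′ (splitAt-↑ʳ n₁ n₂ b)

  parTgt-↑ˡ : ∀ a → parTgt P₁ P₂ (a ↑ˡ m₂) ≡ inj₁ (tgt P₁ a)
  parTgt-↑ˡ a = cong [ inj₁ ∘ tgt P₁ , inj₂ ∘ tgt P₂ ]′ (splitAt-↑ˡ m₁ a m₂)

  parTgt-↑ʳ : ∀ b → parTgt P₁ P₂ (m₁ ↑ʳ b) ≡ inj₂ (tgt P₂ b)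
  parTgt-↑ʳ b = cong [ inj₁ ∘ tgt P₁ , inj₂ ∘ tgt P₂ ]′ (splitAt-↑ʳ m₁ m₂ b)

  data Matched : Fin (n₁ + n₂) → Fin (m₁ + m₂) → Set where
    left  : ∀ {a c} → src P₁ a ≡ tgt P₁ c → Matched (a ↑ˡ n₂) (c ↑ˡ m₂)
    right : ∀ {b d} → src P₂ b ≡ tgt P₂ d → Matched (n₁ ↑ʳ b) (m₁ ↑ʳ d)

  matched : ∀ {i j} → parSrc P₁ P₂ i ≡ parTgt P₁ P₂ j → Matched i j
  matched {i} {j} e with splitView n₁ n₂ i | splitView m₁ m₂ j
  ... | left a  | left c  = left  (inj₁-injective (trans (sym (parSrc-↑ˡ a)) (trans e (parTgt-↑ˡ c))))
  ... | right b | right d = right (inj₂-injective (trans (sym (parSrc-↑ʳ b)) (trans e (parTgt-↑ʳ d))))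
  ... | left a  | right d with () ← trans (sym (parSrc-↑ˡ a)) (trans e (parTgt-↑ʳ d))
  ... | right b | left c  with () ← trans (sym (parSrc-↑ʳ b)) (trans e (parTgt-↑ˡ c))

  parallel-monotone : Monotone (src P₁) (tgt P₁) → Monotone (src P₂) (tgt P₂) →
    Monotone (parSrc P₁ P₂) (parTgt P₁ P₂)
  parallel-monotone mono₁ mono₂ e e′ i<i′ with matched e | matched e′
  ... | left x          | left y           = Equivalence.from ↑ˡ-<-↑ˡ (mono₁ x y (Equivalence.to ↑ˡ-<-↑ˡ i<i′))
  ... | right x         | right y          = Equivalence.from ↑ʳ-<-↑ʳ (mono₂ x y (Equivalence.to ↑ʳ-<-↑ʳ i<i′))
  ... | left {c = c} _  | right {d = d} _  = ↑ˡ<↑ʳ c d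
  ... | right {b = b} _ | left {a = a} _   = contradiction i<i′ (<-asym (↑ˡ<↑ʳ a b))

Fin≤1-unique : ∀ {a} → a ≤ 1 → (x y : Fin a) → x ≡ y
Fin≤1-unique (s≤s z≤n) zero zero = refl

glue-matched : ∀ {k} {P₁ : Iposet n k} {P₂ : Iposet k m} {x y} → Identified P₁ P₂ (inj₁ x) (inj₂ y) →
  ∃ λ l → x ≡ tgt P₁ l × src P₂ l ≡ y
glue-matched (inj₂ (inj₁ (l , refl , refl))) = l , refl , refl

GP⇒monotone : ∀ {P : Iposet s t} → GP P → Monotone (src P) (tgt P)
GP⇒monotone (gp-empty P no-points) {i} _ _ _ = ⊥-elim (¬Fin0 (subst Fin no-points (Inverse.to (enum P) (src P i))))
GP⇒monotone (gp-one P a≤1 _ _) {i} {i′} _ _ i<i′ = contradiction (Fin≤1-unique a≤1 i i′) (<⇒≢ i<i′)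
GP⇒monotone (gp-par {P₁ = P₁} {P₂ = P₂} P gp₁ gp₂ (f , _ , f-src , f-tgt)) e e′ =
  parallel-monotone P₁ P₂ (GP⇒monotone gp₁) (GP⇒monotone gp₂) (unparallel e) (unparallel e′)
  where
  unparallel : ∀ {i j} → src P i ≡ tgt P j → parSrc P₁ P₂ i ≡ parTgt P₁ P₂ j
  unparallel {i} {j} e = ↔-injective f (trans (f-src i) (trans e (sym (f-tgt j))))
GP⇒monotone (gp-glue {P₁ = P₁} {P₂ = P₂} P gp₁ gp₂ (q , _ , q-kernel , _ , q-src , q-tgt)) e e′ i<i′
  with l , x , y ← glue-matched {P₁ = P₁} {P₂ = P₂} (Equivalence.to (q-kernel _ _) (trans (q-src _) (trans e (sym (q-tgt _)))))
  with l′ , x′ , y′ ← glue-matched {P₁ = P₁} {P₂ = P₂} (Equivalence.to (q-kernel _ _) (trans (q-src _) (trans e′ (sym (q-tgt _)))))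
  = GP⇒monotone gp₂ y y′ (GP⇒monotone gp₁ x x′ i<i′)

module _ (P : Iposet a b) (points≡n : points P ≡ n) where

  enumeration : Carrier P ↔ Fin n
  enumeration = subst (λ k → Carrier P ↔ Fin k) points≡n (enum P)

  relabelling⇒≅ : ∀ {L : Layout n a b} → Discrete P →
    Relabelling (Inverse.to enumeration ∘ src P) (Inverse.to enumeration ∘ tgt P) L → P ≅ ⟦ L ⟧
  relabelling⇒≅ discrete (π , π-src , π-tgt) =
    ↔-trans enumeration π , (λ x y → mk⇔ (discrete x y) λ ()) , π-src , π-tgt

  classify : Discrete P → Σ[ c ∈ Code Matching n a b ] P ≅ ⟦ layout c ⟧
  classify discrete =
    let c , ρ = encode n _ _ (src-inj P ∘ ↔-injective enumeration) (tgt-inj P ∘ ↔-injective enumeration)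
    in c , relabelling⇒≅ discrete ρ

  classifyMonotone : GP P → Discrete P → Σ[ c ∈ Code MonotoneMatching n a b ] P ≅ ⟦ monotoneLayout c ⟧
  classifyMonotone gp discrete =
    let c , ρ = encodeMonotone n _ _ (src-inj P ∘ ↔-injective enumeration) (tgt-inj P ∘ ↔-injective enumeration)
                  (monotone-injective (↔-injective enumeration) (GP⇒monotone gp))
    in c , relabelling⇒≅ discrete ρ

AnyCode : (ℕ → ℕ → ℕ → Set) → ℕ → Set
AnyCode Match n = Σ[ a ∈ ℕ ] Σ[ b ∈ ℕ ] Code Match n a b

codeIposet : AnyCode Matching n → AnyIposet
codeIposet (a , b , c) = ⟨ a , b , ⟦ layout c ⟧ ⟩

monotoneCodeIposet : AnyCode MonotoneMatching n → AnyIposet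
monotoneCodeIposet (a , b , c) = ⟨ a , b , ⟦ monotoneLayout c ⟧ ⟩

codeIposet-injective : (c c′ : AnyCode Matching n) → codeIposet c ≅ₐ codeIposet c′ → c ≡ c′
codeIposet-injective (a , b , code (S , I) _) (a , b , code (S′ , I′) _) (refl , refl , iso)
  with refl ← layoutOf-injective S I S′ I′ _ _ (≅⇒sameMatching iso) = refl

monotoneCodeIposet-injective : (c c′ : AnyCode MonotoneMatching n) →
  monotoneCodeIposet c ≅ₐ monotoneCodeIposet c′ → c ≡ c′
monotoneCodeIposet-injective (a , b , code (S , T) _) (a , b , code (S′ , T′) _) (refl , refl , iso)
  with refl ← monotoneLayoutOf-injective S T S′ T′ _ _ (≅⇒sameMatching iso) = refl

monotoneCodeIposet-GP : (c : AnyCode MonotoneMatching n) → IsGP (monotoneCodeIposet c)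
monotoneCodeIposet-GP (_ , _ , code (S , T) fits) = ordered⇒GP _ (monotoneLayoutOf-ordered S T fits)

injective⇒surjective : {f : Fin n → Fin n} → Injective _≡_ _≡_ f → Surjective _≡_ _≡_ f
injective⇒surjective {suc n} {f} f-inj y with any? (λ x → f x ≟ y)
... | yes (x , fx≡y) = x , λ { refl → fx≡y }
... | no y∉image = contradiction (injective⇒≤ {f = g} g-injective) 1+n≰n
  where
  avoids : ∀ x → y ≢ f x
  avoids x y≡fx = y∉image (x , sym y≡fx)
  g : Fin (suc n) → Fin n
  g x = punchOut (avoids x)
  g-injective : Injective _≡_ _≡_ g
  g-injective e = f-inj (punchOut-injective (avoids _) (avoids _) e)

layout-discrete : (L : Layout n a b) → Discrete ⟦ L ⟧
layout-discrete L _ _ ()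

layout-starter : (L : Layout n a n) → Starter ⟦ L ⟧
layout-starter L = layout-discrete L , targetMap-injective L , injective⇒surjective (targetMap-injective L)

layout-terminator : (L : Layout n n b) → Terminator ⟦ L ⟧
layout-terminator L = layout-discrete L , sourceMap-injective L , injective⇒surjective (sourceMap-injective L)

bijective⇒≡points : ∀ {k} (P : Iposet a b) {f : Fin k → Carrier P} → Bijective _≡_ _≡_ f → k ≡ points P
bijective⇒≡points P f-bijective = ↔⇒≡ (↔-trans (⤖⇒↔ (mk⤖ f-bijective)) (enum P))

all-sources-matched : ∀ {a n u} → u ≤ a → .(a + n ≤ n + u) → u ≡ a
all-sources-matched {a} {n} {u} u≤a fits =
  ≤-antisym u≤a (recompute (a ≤? u) (+-cancelʳ-≤ n a u (≤-trans fits (≤-reflexive (+-comm n u)))))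

all-targets-matched : ∀ {b n u} → u ≤ b → .(n + b ≤ n + u) → u ≡ b
all-targets-matched {b} {n} {u} u≤b fits = ≤-antisym u≤b (recompute (b ≤? u) (+-cancelˡ-≤ n b u fits))

-- Counting isomorphism classes

numIsoClasses : ∀ {Φ : AnyIposet → Set₁} {N} {K : Set} (e : Fin N ↔ K) (rep : K → AnyIposet) →
  (∀ k → Φ (rep k)) → (∀ k k′ → rep k ≅ₐ rep k′ → k ≡ k′) → (∀ P → Φ P → ∃ λ k → P ≅ₐ rep k) →
  NumIsoClasses Φ N
numIsoClasses e rep Φ-rep rep-injective complete =
  rep ∘ Inverse.to e ,
  (λ i → Φ-rep (Inverse.to e i)) ,
  (λ i j iso → ↔-injective e (rep-injective _ _ iso)) ,
  λ P ΦP → let k , iso = complete P ΦP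
           in Inverse.from e k , subst (λ k → P ≅ₐ rep k) (sym (Inverse.strictlyInverseˡ e k)) iso

BoundedCode : (ℕ → ℕ → ℕ → Set) → ℕ → Set
BoundedCode Match n =
  Σ[ s ∈ Between 0 n ] Σ[ t ∈ Between 0 n ] Σ[ u ∈ Between (value s + value t ∸ n) (value s ⊓ value t) ]
  Match (value s) (value t) (value u)

BoundedCode↔AnyCode : ∀ {Match : ℕ → ℕ → ℕ → Set} → (∀ {s t u} → Match s t u → u ≤ s × u ≤ t) →
  BoundedCode Match n ↔ AnyCode Match n
BoundedCode↔AnyCode {n} {Match} match-≤ = mk↔ₛ′ to from (λ _ → refl) (λ _ → refl)
  where
  to : BoundedCode Match n → AnyCode Match n
  to ((s , _) , (t , _) , (u , [ u-bounds ]) , m) =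
    s , t , code m (≤-trans (m≤n+m∸n (s + t) n) (+-monoʳ-≤ n (proj₁ u-bounds)))
  from : AnyCode Match n → BoundedCode Match n
  from (s , t , code {u} m fits) =
      (s , [ z≤n , +-cancelʳ-≤ t s n (≤-trans fits (+-monoʳ-≤ n u≤t)) ])
    , (t , [ z≤n , +-cancelˡ-≤ s t n (≤-trans fits (≤-trans (+-monoʳ-≤ n u≤s) (≤-reflexive (+-comm n s)))) ])
    , (u , [ m≤n+o⇒m∸n≤o (s + t) n fits , ⊓-glb u≤s u≤t ])
    , m
    where
    u≤s : u ≤ s
    u≤s = proj₁ (match-≤ m)
    u≤t : u ≤ t
    u≤t = proj₂ (match-≤ m)

Fin[sum]↔AnyCode : ∀ {Match : ℕ → ℕ → ℕ → Set} (f : ℕ → ℕ → ℕ → ℕ) →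
  (∀ s t u → Fin (f s t u) ↔ Match s t u) → (∀ {s t u} → Match s t u → u ≤ s × u ≤ t) →
  Fin (sumFromTo 0 n λ s → sumFromTo 0 n λ t → sumFromTo (s + t ∸ n) (s ⊓ t) (f s t)) ↔ AnyCode Match n
Fin[sum]↔AnyCode {n} f Fin↔Match match-≤ =
  ↔-trans (Fin-sumFromTo↔Σ 0 n _)
  (↔-trans (Σ-↔ ↔-refl (Fin-sumFromTo↔Σ 0 n _))
  (↔-trans (Σ-↔ ↔-refl (Σ-↔ ↔-refl (Fin-sumFromTo↔Σ _ _ _)))
  (↔-trans (Σ-↔ ↔-refl (Σ-↔ ↔-refl (Σ-↔ ↔-refl (Fin↔Match _ _ _))))
  (BoundedCode↔AnyCode match-≤))))

discreteClasses : NumIsoClasses (λ P → Lift (lsuc 0ℓ) (IsDiscrete P × OnPoints n P)) (discreteCount n)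
discreteClasses {n} =
  numIsoClasses (Fin[sum]↔AnyCode _ Fin↔Combination×Arrangement λ (S , I) → combination-≤ S , arrangement-≤ I)
    codeIposet (λ (_ , _ , c) → lift (layout-discrete (layout c) , refl)) codeIposet-injective complete
  where
  complete : ∀ P → Lift (lsuc 0ℓ) (IsDiscrete P × OnPoints n P) → ∃ λ c → P ≅ₐ codeIposet c
  complete ⟨ a , b , P ⟩ (lift (discrete , points≡n)) =
    let c , iso = classify P points≡n discrete in (a , b , c) , refl , refl , iso

discreteGPClasses : NumIsoClasses (λ P → IsGP P × Lift (lsuc 0ℓ) (IsDiscrete P × OnPoints n P)) (discreteGPCount n)
discreteGPClasses {n} =
  numIsoClasses (Fin[sum]↔AnyCode _ Fin↔Combination×Combination λ (S , T) → combination-≤ S , combination-≤ T)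
    monotoneCodeIposet
    (λ c@(_ , _ , c′) → monotoneCodeIposet-GP c , lift (layout-discrete (monotoneLayout c′) , refl))
    monotoneCodeIposet-injective complete
  where
  complete : ∀ P → IsGP P × Lift (lsuc 0ℓ) (IsDiscrete P × OnPoints n P) → ∃ λ c → P ≅ₐ monotoneCodeIposet c
  complete ⟨ a , b , P ⟩ (gp , lift (discrete , points≡n)) =
    let c , iso = classifyMonotone P points≡n gp discrete in (a , b , c) , refl , refl , iso

StarterCode : ℕ → Set
StarterCode n = Σ[ s ∈ Between 0 n ] Arrangement n (value s)

starterCode : StarterCode n → AnyCode Matching n
starterCode {n} ((s , _) , I) = s , n , code (all s , I) (≤-reflexive (+-comm s n))

starterCode-injective : (k k′ : StarterCode n) → starterCode k ≡ starterCode k′ → k ≡ k′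
starterCode-injective ((s , _) , I) ((s , _) , I) refl = refl

starterCode-surjective : (c : Code Matching n a n) → ∃ λ k → starterCode k ≡ (a , n , c)
starterCode-surjective (code (S , I) fits)
  with refl ← all-sources-matched (combination-≤ S) fits
  with refl ← all-unique S
  = ((_ , [ z≤n , arrangement-≤ I ]) , I) , refl

Fin[starterCount]↔StarterCode : Fin (starterCount n) ↔ StarterCode n
Fin[starterCount]↔StarterCode {n} =
  ↔-trans (Fin-sumFromTo↔Σ 0 n _)
    (Σ-↔ reverse λ { {k , [ p ]} → Fin[n!/k!]↔Arrangement (recompute (k ≤? n) (proj₂ p)) })

starterClasses : NumIsoClasses (λ P → Lift (lsuc 0ℓ) (IsStarter P × OnPoints n P)) (starterCount n)
starterClasses {n} =
  numIsoClasses Fin[starterCount]↔StarterCode (codeIposet ∘ starterCode)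
    (λ ((s , _) , I) → lift (layout-starter (layoutOf (all s) I n _) , refl))
    (λ k k′ iso → starterCode-injective k k′ (codeIposet-injective _ _ iso))
    complete
  where
  complete : ∀ P → Lift (lsuc 0ℓ) (IsStarter P × OnPoints n P) → ∃ λ k → P ≅ₐ codeIposet (starterCode k)
  complete ⟨ a , b , P ⟩ (lift ((discrete , tgt-bijective) , points≡n))
    with refl ← trans (bijective⇒≡points P tgt-bijective) points≡n =
    let c , iso = classify P points≡n discrete
        k , k↦c = starterCode-surjective c
    in k , subst (⟨ a , n , P ⟩ ≅ₐ_) (cong codeIposet (sym k↦c)) (refl , refl , iso)

TerminatorCode : ℕ → Set
TerminatorCode n = Σ[ t ∈ Between 0 n ] Combination n (value t) × Arrangement (value t) (value t)

terminatorCode : TerminatorCode n → AnyCode Matching n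
terminatorCode {n} ((t , _) , S , I) = n , t , code (S , I) ≤-refl

terminatorCode-injective : (k k′ : TerminatorCode n) → terminatorCode k ≡ terminatorCode k′ → k ≡ k′
terminatorCode-injective ((t , _) , S , I) ((t , _) , S , I) refl = refl

terminatorCode-surjective : (c : Code Matching n n b) → ∃ λ k → terminatorCode k ≡ (n , b , c)
terminatorCode-surjective (code (S , I) fits)
  with refl ← all-targets-matched (arrangement-≤ I) fits
  = ((_ , [ z≤n , combination-≤ S ]) , S , I) , refl

Fin[starterCount]↔TerminatorCode : Fin (starterCount n) ↔ TerminatorCode n
Fin[starterCount]↔TerminatorCode {n} =
  ↔-trans (Fin-sumFromTo↔Σ 0 n _)
    (Σ-↔ reverse λ { {k , [ p ]} → Fin[n!/k!]↔Combination×Arrangement (recompute (k ≤? n) (proj₂ p)) })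

terminatorClasses : NumIsoClasses (λ P → Lift (lsuc 0ℓ) (IsTerminator P × OnPoints n P)) (starterCount n)
terminatorClasses {n} =
  numIsoClasses Fin[starterCount]↔TerminatorCode (codeIposet ∘ terminatorCode)
    (λ ((t , _) , S , I) → lift (layout-terminator (layoutOf S I n _) , refl))
    (λ k k′ iso → terminatorCode-injective k k′ (codeIposet-injective _ _ iso))
    complete
  where
  complete : ∀ P → Lift (lsuc 0ℓ) (IsTerminator P × OnPoints n P) → ∃ λ k → P ≅ₐ codeIposet (terminatorCode k)
  complete ⟨ a , b , P ⟩ (lift ((discrete , src-bijective) , points≡n))
    with refl ← trans (bijective⇒≡points P src-bijective) points≡n =
    let c , iso = classify P points≡n discrete
        k , k↦c = terminatorCode-surjective c
    in k , subst (⟨ n , b , P ⟩ ≅ₐ_) (cong codeIposet (sym k↦c)) (refl , refl , iso)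

gpStarterCode : Σ ℕ (Combination n) → AnyCode MonotoneMatching n
gpStarterCode {n} (s , T) = s , n , code (all s , T) (≤-reflexive (+-comm s n))

gpStarterCode-injective : (k k′ : Σ ℕ (Combination n)) → gpStarterCode k ≡ gpStarterCode k′ → k ≡ k′
gpStarterCode-injective (s , T) (s , T) refl = refl

gpStarterCode-surjective : (c : Code MonotoneMatching n a n) → ∃ λ k → gpStarterCode k ≡ (a , n , c)
gpStarterCode-surjective (code (S , T) fits)
  with refl ← all-sources-matched (combination-≤ S) fits
  with refl ← all-unique S
  = (_ , T) , refl

gpStarterClasses : NumIsoClasses (λ P → IsGP P × Lift (lsuc 0ℓ) (IsStarter P × OnPoints n P)) (2 ^ n)
gpStarterClasses {n} =
  numIsoClasses (Fin[2^n]↔Combination n) (monotoneCodeIposet ∘ gpStarterCode)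
    (λ k@(s , T) → monotoneCodeIposet-GP (gpStarterCode k) , lift (layout-starter (monotoneLayoutOf (all s) T n _) , refl))
    (λ k k′ iso → gpStarterCode-injective k k′ (monotoneCodeIposet-injective _ _ iso))
    complete
  where
  complete : ∀ P → IsGP P × Lift (lsuc 0ℓ) (IsStarter P × OnPoints n P) →
    ∃ λ k → P ≅ₐ monotoneCodeIposet (gpStarterCode k)
  complete ⟨ a , b , P ⟩ (gp , lift ((discrete , tgt-bijective) , points≡n))
    with refl ← trans (bijective⇒≡points P tgt-bijective) points≡n =
    let c , iso = classifyMonotone P points≡n gp discrete
        k , k↦c = gpStarterCode-surjective c
    in k , subst (⟨ a , n , P ⟩ ≅ₐ_) (cong monotoneCodeIposet (sym k↦c)) (refl , refl , iso)

gpTerminatorCode : Σ ℕ (Combination n) → AnyCode MonotoneMatching n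
gpTerminatorCode {n} (t , S) = n , t , code (S , all t) ≤-refl

gpTerminatorCode-injective : (k k′ : Σ ℕ (Combination n)) → gpTerminatorCode k ≡ gpTerminatorCode k′ → k ≡ k′
gpTerminatorCode-injective (t , S) (t , S) refl = refl

gpTerminatorCode-surjective : (c : Code MonotoneMatching n n b) → ∃ λ k → gpTerminatorCode k ≡ (n , b , c)
gpTerminatorCode-surjective (code (S , T) fits)
  with refl ← all-targets-matched (combination-≤ T) fits
  with refl ← all-unique T
  = (_ , S) , refl

gpTerminatorClasses : NumIsoClasses (λ P → IsGP P × Lift (lsuc 0ℓ) (IsTerminator P × OnPoints n P)) (2 ^ n)
gpTerminatorClasses {n} =
  numIsoClasses (Fin[2^n]↔Combination n) (monotoneCodeIposet ∘ gpTerminatorCode)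
    (λ k@(t , S) → monotoneCodeIposet-GP (gpTerminatorCode k) , lift (layout-terminator (monotoneLayoutOf S (all t) n _) , refl))
    (λ k k′ iso → gpTerminatorCode-injective k k′ (monotoneCodeIposet-injective _ _ iso))
    complete
  where
  complete : ∀ P → IsGP P × Lift (lsuc 0ℓ) (IsTerminator P × OnPoints n P) →
    ∃ λ k → P ≅ₐ monotoneCodeIposet (gpTerminatorCode k)
  complete ⟨ a , b , P ⟩ (gp , lift ((discrete , src-bijective) , points≡n))
    with refl ← trans (bijective⇒≡points P src-bijective) points≡n =
    let c , iso = classifyMonotone P points≡n gp discrete
        k , k↦c = gpTerminatorCode-surjective c
    in k , subst (⟨ n , b , P ⟩ ≅ₐ_) (cong monotoneCodeIposet (sym k↦c)) (refl , refl , iso)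

proposition3 : (n : ℕ) →
    NumIsoClasses (λ P → IsGP P × Lift (lsuc 0ℓ) (IsStarter P × OnPoints n P)) (2 ^ n)
    × NumIsoClasses (λ P → IsGP P × Lift (lsuc 0ℓ) (IsTerminator P × OnPoints n P)) (2 ^ n)
    × NumIsoClasses (λ P → Lift (lsuc 0ℓ) (IsStarter P × OnPoints n P)) (starterCount n)
    × NumIsoClasses (λ P → Lift (lsuc 0ℓ) (IsTerminator P × OnPoints n P)) (starterCount n)
    × NumIsoClasses (λ P → IsGP P × Lift (lsuc 0ℓ) (IsDiscrete P × OnPoints n P)) (discreteGPCount n)
    × NumIsoClasses (λ P → Lift (lsuc 0ℓ) (IsDiscrete P × OnPoints n P)) (discreteCount n)
proposition3 n =
  gpStarterClasses , gpTerminatorClasses , starterClasses , terminatorClasses , discreteGPClasses , discreteClasses
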